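{- Let $M,N$ be EPCF programs. (1) If $M\to_{\mathsf{cr}}N$ then $M^{\downarrow}\to_{\mathsf{PCF}}N^{\downarrow}$. (2) If $M\to_{\mathsf{pr}}N$ then $M^{\downarrow}=N^{\downarrow}$.
   Context: PCF terms: $P::=x\mid \lambda x.P\mid P\cdot Q\mid \mathbf{fix}\,P\mid \mathbf{0}\mid \mathbf{pred}\,P\mid \mathbf{succ}\,P\mid \mathbf{ifz}(P,Q,Q')$, up to $\alpha$-conversion, $P\{Q/x\}$ capture-free substitution, $\underline n=\mathbf{succ}^n(\mathbf 0)$. PCF evaluation contexts $E::=\square\mid E\cdot P\mid\mathbf{pred}\,E\mid\mathbf{succ}\,E\mid\mathbf{ifz}(E,P,Q)$; $\to_{\mathsf{PCF}}$: $E[(\lambda x.P)Q]\to E[P\{Q/x\}]$, $E[\mathbf{fix}\,P]\to E[P\cdot\mathbf{fix}\,P]$, $E[\mathbf{pred}(\mathbf{succ}\,\underline n)]\to E[\underline n]$, $E[\mathbf{pred}\,\mathbf 0]\to E[\mathbf 0]$, $E[\mathbf{ifz}(\mathbf 0,P_1,P_2)]\to E[P_1]$, $E[\mathbf{ifz}(\underline{n+1},P_1,P_2)]\to E[P_2]$. EPCF terms add explicit substitutions $M\langle N/x\rangle$ ($x$ bound in $M$). For $\sigma=\langle N_1/x_1\rangle\cdots\langle N_n/x_n\rangle$ ($x_i$ distinct), $M^\sigma=(\cdots(M\langle N_1/x_1\rangle)\cdots)\langle N_n/x_n\rangle$, $\mathrm{dom}(\sigma)=\{x_i\}$, $\sigma(x_i)=N_i$.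 An EPCF program is a closed EPCF term all of whose subterms $M\langle N/x\rangle$ have $N$ closed. EPCF evaluation contexts are as for PCF over EPCF terms. $\to_{\mathsf{cr}}$: $E[(\lambda x.M)^\sigma N]\to E[M^\sigma\langle N/x\rangle]$, $E[\mathbf{pred}\,\mathbf 0]\to E[\mathbf 0]$, $E[\mathbf{pred}\,\underline{n+1}]\to E[\underline n]$, $E[\mathbf{ifz}(\mathbf 0,M,N)]\to E[M]$, $E[\mathbf{ifz}(\underline{n+1},M,N)]\to E[N]$, $E[\mathbf{fix}\,M]\to E[M(\mathbf{fix}\,M)]$. $\to_{\mathsf{pr}}$ (σ nonempty): $E[x^\sigma]\to E[N]$ if $\sigma(x)=N$; $E[y^\sigma]\to E[y]$ if $y\notin\mathrm{dom}\sigma$; $E[\mathbf 0^\sigma]\to E[\mathbf 0]$; $E[(M\cdot N)^\sigma]\to E[M^\sigma\cdot N^\sigma]$; $E[(\mathbf{pred}\,M)^\sigma]\to E[\mathbf{pred}(M^\sigma)]$; $E[(\mathbf{succ}\,M)^\sigma]\to E[\mathbf{succ}(M^\sigma)]$; $E[\mathbf{ifz}(L,M,N)^\sigma]\to E[\mathbf{ifz}(L^\sigma,M^\sigma,N^\sigma)]$; $E[(\mathbf{fix}\,M)^\sigma]\to E[\mathbf{fix}(M^\sigma)]$. The collapse $M^{\downarrow}$ is the PCF term obtained by performing all explicit substitutions: it commutes with every PCF constructor ($x^\downarrow=x$, $\mathbf 0^\downarrow=\mathbf 0$, $(M\cdot N)^\downarrow=M^\downarrow\cdot N^\downarrow$,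 $(\lambda x.M)^\downarrow=\lambda x.M^\downarrow$, etc.) and $(M\langle N/x\rangle)^\downarrow=M^\downarrow\{N^\downarrow/x\}$. -}

module Defs where

-- Well-scoped de Bruijn syntax for PCF and EPCF (terms up to α-conversion
-- are represented canonically, so α-equality is _≡_).

open import Data.Nat using (ℕ; zero; suc; _+_)
open import Data.Fin using (Fin; zero; suc; _↑ˡ_; _↑ʳ_; splitAt)
open import Data.Sum using (inj₁; inj₂)
open import Data.Vec using (Vec; []; _∷_; lookup)

data PTm (n : ℕ) : Set where
  var  : Fin n → PTm n
  lam  : PTm (suc n) → PTm n
  app  : PTm n → PTm n → PTm n
  fix  : PTm n → PTm n
  zer  : PTm n
  pred : PTm n → PTm n
  succ : PTm n → PTm n
  ifz  : PTm n → PTm n → PTm n → PTm n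

pnum : ∀ {n} → ℕ → PTm n
pnum zero    = zer
pnum (suc k) = succ (pnum k)

pext : ∀ {m n} → (Fin m → Fin n) → Fin (suc m) → Fin (suc n)
pext ρ zero    = zero
pext ρ (suc i) = suc (ρ i)

pren : ∀ {m n} → (Fin m → Fin n) → PTm m → PTm n
pren ρ (var i)     = var (ρ i)
pren ρ (lam P)     = lam (pren (pext ρ) P)
pren ρ (app P Q)   = app (pren ρ P) (pren ρ Q)
pren ρ (fix P)     = fix (pren ρ P)
pren ρ zer         = zer
pren ρ (pred P)    = pred (pren ρ P)
pren ρ (succ P)    = succ (pren ρ P)
pren ρ (ifz P Q R) = ifz (pren ρ P) (pren ρ Q) (pren ρ R)

pexts : ∀ {m n} → (Fin m → PTm n) → Fin (suc m) → PTm (suc n)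
pexts s zero    = var zero
pexts s (suc i) = pren suc (s i)

psub : ∀ {m n} → (Fin m → PTm n) → PTm m → PTm n
psub s (var i)     = s i
psub s (lam P)     = lam (psub (pexts s) P)
psub s (app P Q)   = app (psub s P) (psub s Q)
psub s (fix P)     = fix (psub s P)
psub s zer         = zer
psub s (pred P)    = pred (psub s P)
psub s (succ P)    = succ (psub s P)
psub s (ifz P Q R) = ifz (psub s P) (psub s Q) (psub s R)

single : ∀ {n} → PTm n → Fin (suc n) → PTm n
single Q zero    = Q
single Q (suc i) = var i

_[_/0] : ∀ {n} → PTm (suc n) → PTm n → PTm n
P [ Q /0] = psub (single Q) P

data PCtx (n : ℕ) : Set where
  hole  : PCtx n
  appC  : PCtx n → PTm n → PCtx n
  predC : PCtx n → PCtx n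
  succC : PCtx n → PCtx n
  ifzC  : PCtx n → PTm n → PTm n → PCtx n

pplug : ∀ {n} → PCtx n → PTm n → PTm n
pplug hole          P = P
pplug (appC E Q)    P = app (pplug E P) Q
pplug (predC E)     P = pred (pplug E P)
pplug (succC E)     P = succ (pplug E P)
pplug (ifzC E Q R)  P = ifz (pplug E P) Q R

data _⊳PCF_ {n : ℕ} : PTm n → PTm n → Set where
  β     : ∀ P Q → app (lam P) Q ⊳PCF (P [ Q /0])
  fixβ  : ∀ P → fix P ⊳PCF app P (fix P)
  predS : ∀ k → pred (succ (pnum k)) ⊳PCF pnum k
  pred0 : pred zer ⊳PCF zer
  ifz0  : ∀ P Q → ifz zer P Q ⊳PCF P
  ifzS  : ∀ k P Q → ifz (pnum (suc k)) P Q ⊳PCF Q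

data _→PCF_ {n : ℕ} : PTm n → PTm n → Set where
  ctx : ∀ (E : PCtx n) {P Q} → P ⊳PCF Q → pplug E P →PCF pplug E Q

-- An explicit substitution  es M N  stands for  M⟨N/x⟩ where
-- x is de Bruijn index 0 of M.  Since we only consider EPCF *programs*
-- (closed terms all of whose explicit substitutions M⟨N/x⟩ have N closed),
-- the substituted term N is required to be closed (ETm 0); EPCF programs
-- are then exactly the closed terms ETm 0.

data ETm (n : ℕ) : Set where
  var  : Fin n → ETm n
  lam  : ETm (suc n) → ETm n
  app  : ETm n → ETm n → ETm n
  fix  : ETm n → ETm n
  zer  : ETm n
  pred : ETm n → ETm n
  succ : ETm n → ETm n
  ifz  : ETm n → ETm n → ETm n → ETm n
  es   : ETm (suc n) → ETm 0 → ETm n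

Program : Set
Program = ETm 0

enum : ∀ {n} → ℕ → ETm n
enum zero    = zer
enum (suc k) = succ (enum k)

eren : ∀ {m n} → (Fin m → Fin n) → ETm m → ETm n
eren ρ (var i)     = var (ρ i)
eren ρ (lam M)     = lam (eren (pext ρ) M)
eren ρ (app M N)   = app (eren ρ M) (eren ρ N)
eren ρ (fix M)     = fix (eren ρ M)
eren ρ zer         = zer
eren ρ (pred M)    = pred (eren ρ M)
eren ρ (succ M)    = succ (eren ρ M)
eren ρ (ifz L M N) = ifz (eren ρ L) (eren ρ M) (eren ρ N)
eren ρ (es M N)    = es (eren (pext ρ) M) N

-- M^σ for σ = ⟨N₁/x₁⟩⋯⟨N_k/x_k⟩ : the innermost substitution ⟨N₁/x₁⟩
-- binds index 0 of M, ..., ⟨N_k/x_k⟩ binds index k-1 (x_i distinct is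
-- automatic with de Bruijn indices).  Index k+j of M becomes index j.
_^_ : ∀ {k n} → ETm (k + n) → Vec (ETm 0) k → ETm n
M ^ []      = M
M ^ (N ∷ σ) = es M N ^ σ

-- moving the variable 0 of a body past k binders: in (λx.M)^σ the λ-bound
-- x is index 0 of M, but in M^σ⟨N/x⟩ the variable x is bound outermost,
-- i.e. it must become index k, while index 1+i becomes i.
moveOut : ∀ k {n} → Fin (suc (k + n)) → Fin (k + suc n)
moveOut k zero    = k ↑ʳ zero
moveOut k {n} (suc i) with splitAt k i
... | inj₁ a = a ↑ˡ suc n
... | inj₂ b = k ↑ʳ suc b

data ECtx : Set where
  hole  : ECtx
  appC  : ECtx → ETm 0 → ECtx
  predC : ECtx → ECtx
  succC : ECtx → ECtx
  ifzC  : ECtx → ETm 0 → ETm 0 → ECtx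

eplug : ECtx → ETm 0 → ETm 0
eplug hole          M = M
eplug (appC E N)    M = app (eplug E M) N
eplug (predC E)     M = pred (eplug E M)
eplug (succC E)     M = succ (eplug E M)
eplug (ifzC E N L)  M = ifz (eplug E M) N L

data _⊳cr_ : ETm 0 → ETm 0 → Set where
  β     : ∀ {k} (M : ETm (suc (k + 0))) (σ : Vec (ETm 0) k) (N : ETm 0) →
          app (lam M ^ σ) N ⊳cr es (eren (moveOut k) M ^ σ) N
  pred0 : pred zer ⊳cr zer
  predS : ∀ k → pred (enum (suc k)) ⊳cr enum k
  ifz0  : ∀ M N → ifz zer M N ⊳cr M
  ifzS  : ∀ k M N → ifz (enum (suc k)) M N ⊳cr N
  fixβ  : ∀ M → fix M ⊳cr app M (fix M)

data _⊳pr_ : ETm 0 → ETm 0 → Set where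
  varIn  : ∀ {k} (σ : Vec (ETm 0) (suc k)) (i : Fin (suc k)) →
           (var (i ↑ˡ 0) ^ σ) ⊳pr lookup σ i
  varOut : ∀ {k} (σ : Vec (ETm 0) (suc k)) (j : Fin 0) →
           (var (suc k ↑ʳ j) ^ σ) ⊳pr var j
  zer^   : ∀ {k} (σ : Vec (ETm 0) (suc k)) → (zer ^ σ) ⊳pr zer
  app^   : ∀ {k} (σ : Vec (ETm 0) (suc k)) M N →
           (app M N ^ σ) ⊳pr app (M ^ σ) (N ^ σ)
  pred^  : ∀ {k} (σ : Vec (ETm 0) (suc k)) M →
           (pred M ^ σ) ⊳pr pred (M ^ σ)
  succ^  : ∀ {k} (σ : Vec (ETm 0) (suc k)) M →
           (succ M ^ σ) ⊳pr succ (M ^ σ)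
  ifz^   : ∀ {k} (σ : Vec (ETm 0) (suc k)) L M N →
           (ifz L M N ^ σ) ⊳pr ifz (L ^ σ) (M ^ σ) (N ^ σ)
  fix^   : ∀ {k} (σ : Vec (ETm 0) (suc k)) M →
           (fix M ^ σ) ⊳pr fix (M ^ σ)

data _→cr_ : ETm 0 → ETm 0 → Set where
  ctx : ∀ (E : ECtx) {M N} → M ⊳cr N → eplug E M →cr eplug E N

data _→pr_ : ETm 0 → ETm 0 → Set where
  ctx : ∀ (E : ECtx) {M N} → M ⊳pr N → eplug E M →pr eplug E N

wk0 : ∀ {n} → PTm 0 → PTm n
wk0 = pren (λ ())

_↓ : ∀ {n} → ETm n → PTm n
var i ↓     = var i
lam M ↓     = lam (M ↓)
app M N ↓   = app (M ↓) (N ↓)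
fix M ↓     = fix (M ↓)
zer ↓       = zer
pred M ↓    = pred (M ↓)
succ M ↓    = succ (M ↓)
ifz L M N ↓ = ifz (L ↓) (M ↓) (N ↓)
es M N ↓    = (M ↓) [ wk0 (N ↓) /0]

-- The collapse commutes with renaming, and a closure M ^ σ collapses to the
-- parallel substitution of the collapsed closed terms of σ into M ↓.  Hence
-- every propagation rule is an identity between collapses, each computation
-- rule collapses to the PCF rule of the same name (for β this is the
-- substitution lemma, with moveOut matching the order of the binders), and
-- EPCF evaluation contexts collapse to PCF evaluation contexts.
module Submission where

open import Defs
open import Data.Product using (_×_; _,_)
open import Data.Nat using (zero; suc; _+_)
open import Data.Fin using (Fin; zero; suc; _↑ˡ_; _↑ʳ_; splitAt)
open import Data.Fin.Properties using (splitAt⁻¹-↑ˡ)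
open import Data.Sum using (inj₁)
open import Data.Vec using (Vec; []; _∷_; lookup)
open import Function using (_∘_)
open import Relation.Binary.PropositionalEquality
  using (_≡_; refl; sym; trans; cong; cong₂; subst₂; module ≡-Reasoning)

open ≡-Reasoning

pext-cong : ∀ {m n} {ρ ρ′ : Fin m → Fin n} →
            (∀ i → ρ i ≡ ρ′ i) → ∀ i → pext ρ i ≡ pext ρ′ i
pext-cong h zero    = refl
pext-cong h (suc i) = cong suc (h i)

pren-cong : ∀ {m n} {ρ ρ′ : Fin m → Fin n} →
            (∀ i → ρ i ≡ ρ′ i) → ∀ P → pren ρ P ≡ pren ρ′ P
pren-cong h (var i)   = cong var (h i)
pren-cong h (lam P)   = cong lam (pren-cong (pext-cong h) P)
pren-cong h (app P Q) = cong₂ app (pren-cong h P) (pren-cong h Q)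
pren-cong h (fix P)   = cong fix (pren-cong h P)
pren-cong h zer       = refl
pren-cong h (pred P)  = cong pred (pren-cong h P)
pren-cong h (succ P)  = cong succ (pren-cong h P)
pren-cong h (ifz P Q R)
  rewrite pren-cong h P | pren-cong h Q | pren-cong h R = refl

pexts-cong : ∀ {m n} {s s′ : Fin m → PTm n} →
             (∀ i → s i ≡ s′ i) → ∀ i → pexts s i ≡ pexts s′ i
pexts-cong h zero    = refl
pexts-cong h (suc i) = cong (pren suc) (h i)

psub-cong : ∀ {m n} {s s′ : Fin m → PTm n} →
            (∀ i → s i ≡ s′ i) → ∀ P → psub s P ≡ psub s′ P
psub-cong h (var i)   = h i
psub-cong h (lam P)   = cong lam (psub-cong (pexts-cong h) P)
psub-cong h (app P Q) = cong₂ app (psub-cong h P) (psub-cong h Q)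
psub-cong h (fix P)   = cong fix (psub-cong h P)
psub-cong h zer       = refl
psub-cong h (pred P)  = cong pred (psub-cong h P)
psub-cong h (succ P)  = cong succ (psub-cong h P)
psub-cong h (ifz P Q R)
  rewrite psub-cong h P | psub-cong h Q | psub-cong h R = refl

pren-pren : ∀ {l m n} (ρ : Fin m → Fin n) (ρ′ : Fin l → Fin m) P →
            pren ρ (pren ρ′ P) ≡ pren (ρ ∘ ρ′) P
pren-pren ρ ρ′ (var i)   = refl
pren-pren ρ ρ′ (lam P)   = cong lam (trans (pren-pren (pext ρ) (pext ρ′) P)
                                           (pren-cong (λ { zero → refl ; (suc i) → refl }) P))
pren-pren ρ ρ′ (app P Q) = cong₂ app (pren-pren ρ ρ′ P) (pren-pren ρ ρ′ Q)
pren-pren ρ ρ′ (fix P)   = cong fix (pren-pren ρ ρ′ P)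
pren-pren ρ ρ′ zer       = refl
pren-pren ρ ρ′ (pred P)  = cong pred (pren-pren ρ ρ′ P)
pren-pren ρ ρ′ (succ P)  = cong succ (pren-pren ρ ρ′ P)
pren-pren ρ ρ′ (ifz P Q R)
  rewrite pren-pren ρ ρ′ P | pren-pren ρ ρ′ Q | pren-pren ρ ρ′ R = refl

psub-pren : ∀ {l m n} (s : Fin m → PTm n) (ρ : Fin l → Fin m) P →
            psub s (pren ρ P) ≡ psub (s ∘ ρ) P
psub-pren s ρ (var i)   = refl
psub-pren s ρ (lam P)   = cong lam (trans (psub-pren (pexts s) (pext ρ) P)
                                          (psub-cong (λ { zero → refl ; (suc i) → refl }) P))
psub-pren s ρ (app P Q) = cong₂ app (psub-pren s ρ P) (psub-pren s ρ Q)
psub-pren s ρ (fix P)   = cong fix (psub-pren s ρ P)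
psub-pren s ρ zer       = refl
psub-pren s ρ (pred P)  = cong pred (psub-pren s ρ P)
psub-pren s ρ (succ P)  = cong succ (psub-pren s ρ P)
psub-pren s ρ (ifz P Q R)
  rewrite psub-pren s ρ P | psub-pren s ρ Q | psub-pren s ρ R = refl

pren-psub : ∀ {l m n} (ρ : Fin m → Fin n) (s : Fin l → PTm m) P →
            pren ρ (psub s P) ≡ psub (pren ρ ∘ s) P
pren-psub ρ s (var i)   = refl
pren-psub ρ s (lam P)   = cong lam (trans (pren-psub (pext ρ) (pexts s) P) (psub-cong pext-pexts P))
  where
  pext-pexts : ∀ i → pren (pext ρ) (pexts s i) ≡ pexts (pren ρ ∘ s) i
  pext-pexts zero    = refl
  pext-pexts (suc i) = trans (pren-pren (pext ρ) suc (s i)) (sym (pren-pren suc ρ (s i)))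
pren-psub ρ s (app P Q) = cong₂ app (pren-psub ρ s P) (pren-psub ρ s Q)
pren-psub ρ s (fix P)   = cong fix (pren-psub ρ s P)
pren-psub ρ s zer       = refl
pren-psub ρ s (pred P)  = cong pred (pren-psub ρ s P)
pren-psub ρ s (succ P)  = cong succ (pren-psub ρ s P)
pren-psub ρ s (ifz P Q R)
  rewrite pren-psub ρ s P | pren-psub ρ s Q | pren-psub ρ s R = refl

psub-psub : ∀ {l m n} (s : Fin m → PTm n) (t : Fin l → PTm m) P →
            psub s (psub t P) ≡ psub (psub s ∘ t) P
psub-psub s t (var i)   = refl
psub-psub s t (lam P)   = cong lam (trans (psub-psub (pexts s) (pexts t) P) (psub-cong pexts-pexts P))
  where
  pexts-pexts : ∀ i → psub (pexts s) (pexts t i) ≡ pexts (psub s ∘ t) i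
  pexts-pexts zero    = refl
  pexts-pexts (suc i) = trans (psub-pren (pexts s) suc (t i)) (sym (pren-psub suc s (t i)))
psub-psub s t (app P Q) = cong₂ app (psub-psub s t P) (psub-psub s t Q)
psub-psub s t (fix P)   = cong fix (psub-psub s t P)
psub-psub s t zer       = refl
psub-psub s t (pred P)  = cong pred (psub-psub s t P)
psub-psub s t (succ P)  = cong succ (psub-psub s t P)
psub-psub s t (ifz P Q R)
  rewrite psub-psub s t P | psub-psub s t Q | psub-psub s t R = refl

psub-var : ∀ {n} (P : PTm n) → psub var P ≡ P
psub-var (var i)   = refl
psub-var (lam P)   = cong lam (trans (psub-cong (λ { zero → refl ; (suc i) → refl }) P) (psub-var P))
psub-var (app P Q) = cong₂ app (psub-var P) (psub-var Q)
psub-var (fix P)   = cong fix (psub-var P)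
psub-var zer       = refl
psub-var (pred P)  = cong pred (psub-var P)
psub-var (succ P)  = cong succ (psub-var P)
psub-var (ifz P Q R) rewrite psub-var P | psub-var Q | psub-var R = refl

pren-as-psub : ∀ {m n} (ρ : Fin m → Fin n) P → pren ρ P ≡ psub (var ∘ ρ) P
pren-as-psub ρ (var i)   = refl
pren-as-psub ρ (lam P)   = cong lam (trans (pren-as-psub (pext ρ) P)
                                           (psub-cong (λ { zero → refl ; (suc i) → refl }) P))
pren-as-psub ρ (app P Q) = cong₂ app (pren-as-psub ρ P) (pren-as-psub ρ Q)
pren-as-psub ρ (fix P)   = cong fix (pren-as-psub ρ P)
pren-as-psub ρ zer       = refl
pren-as-psub ρ (pred P)  = cong pred (pren-as-psub ρ P)
pren-as-psub ρ (succ P)  = cong succ (pren-as-psub ρ P)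
pren-as-psub ρ (ifz P Q R)
  rewrite pren-as-psub ρ P | pren-as-psub ρ Q | pren-as-psub ρ R = refl

weaken-[/0] : ∀ {n} (P Q : PTm n) → pren suc P [ Q /0] ≡ P
weaken-[/0] P Q = trans (psub-pren (single Q) suc P) (psub-var P)

wk0-closed : (P : PTm 0) → wk0 P ≡ P
wk0-closed P = trans (pren-as-psub _ P) (trans (psub-cong (λ ()) P) (psub-var P))

psub-wk0 : ∀ {m n} (s : Fin m → PTm n) (P : PTm 0) → psub s (wk0 P) ≡ wk0 P
psub-wk0 s P = trans (psub-pren s _ P) (trans (psub-cong (λ ()) P) (sym (pren-as-psub _ P)))

pren-wk0 : ∀ {m n} (ρ : Fin m → Fin n) (P : PTm 0) → pren ρ (wk0 P) ≡ wk0 P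
pren-wk0 ρ P = trans (pren-pren ρ _ P) (pren-cong (λ ()) P)

eren-↓ : ∀ {m n} (ρ : Fin m → Fin n) M → eren ρ M ↓ ≡ pren ρ (M ↓)
eren-↓ ρ (var i)   = refl
eren-↓ ρ (lam M)   = cong lam (eren-↓ (pext ρ) M)
eren-↓ ρ (app M N) = cong₂ app (eren-↓ ρ M) (eren-↓ ρ N)
eren-↓ ρ (fix M)   = cong fix (eren-↓ ρ M)
eren-↓ ρ zer       = refl
eren-↓ ρ (pred M)  = cong pred (eren-↓ ρ M)
eren-↓ ρ (succ M)  = cong succ (eren-↓ ρ M)
eren-↓ ρ (ifz L M N) rewrite eren-↓ ρ L | eren-↓ ρ M | eren-↓ ρ N = refl
eren-↓ ρ (es M N) = begin
    psub N′ (eren (pext ρ) M ↓)        ≡⟨ cong (psub N′) (eren-↓ (pext ρ) M) ⟩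
    psub N′ (pren (pext ρ) (M ↓))      ≡⟨ psub-pren N′ (pext ρ) (M ↓) ⟩
    psub (N′ ∘ pext ρ) (M ↓)           ≡⟨ psub-cong single-pext (M ↓) ⟩
    psub (pren ρ ∘ N′) (M ↓)           ≡⟨ sym (pren-psub ρ N′ (M ↓)) ⟩
    pren ρ (psub N′ (M ↓))             ∎
  where
  N′ : ∀ {l} → Fin (suc l) → PTm l
  N′ = single (wk0 (N ↓))
  single-pext : ∀ i → N′ (pext ρ i) ≡ pren ρ (N′ i)
  single-pext zero    = sym (pren-wk0 ρ (N ↓))
  single-pext (suc i) = refl

_↓ˢ : ∀ {k n} → Vec (ETm 0) k → Fin (k + n) → PTm n
([] ↓ˢ) i          = var i
((N ∷ σ) ↓ˢ) zero    = wk0 (N ↓)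
((N ∷ σ) ↓ˢ) (suc i) = (σ ↓ˢ) i

↓ˢ-↑ˡ : ∀ {k} n (σ : Vec (ETm 0) k) i → (σ ↓ˢ) (i ↑ˡ n) ≡ wk0 (lookup σ i ↓)
↓ˢ-↑ˡ n (N ∷ σ) zero    = refl
↓ˢ-↑ˡ n (N ∷ σ) (suc i) = ↓ˢ-↑ˡ n σ i

↓ˢ-↑ʳ : ∀ {k n} (σ : Vec (ETm 0) k) (j : Fin n) → (σ ↓ˢ) (k ↑ʳ j) ≡ var j
↓ˢ-↑ʳ []      j = refl
↓ˢ-↑ʳ (N ∷ σ) j = ↓ˢ-↑ʳ σ j

^-↓ : ∀ {k n} (M : ETm (k + n)) (σ : Vec (ETm 0) k) → (M ^ σ) ↓ ≡ psub (σ ↓ˢ) (M ↓)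
^-↓ M []      = sym (psub-var (M ↓))
^-↓ M (N ∷ σ) = begin
    (es M N ^ σ) ↓                               ≡⟨ ^-↓ (es M N) σ ⟩
    psub (σ ↓ˢ) (psub (single (wk0 (N ↓))) (M ↓)) ≡⟨ psub-psub (σ ↓ˢ) _ (M ↓) ⟩
    psub (psub (σ ↓ˢ) ∘ single (wk0 (N ↓))) (M ↓) ≡⟨ psub-cong single-↓ˢ (M ↓) ⟩
    psub ((N ∷ σ) ↓ˢ) (M ↓)                      ∎
  where
  single-↓ˢ : ∀ i → psub (σ ↓ˢ) (single (wk0 (N ↓)) i) ≡ ((N ∷ σ) ↓ˢ) i
  single-↓ˢ zero    = psub-wk0 (σ ↓ˢ) (N ↓)
  single-↓ˢ (suc i) = refl

pexts-↓ˢ-moveOut : ∀ {k} (σ : Vec (ETm 0) k) (Q : PTm 0) i →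
                   psub (single Q) (pexts (σ ↓ˢ) i) ≡ psub (single (wk0 Q)) ((σ ↓ˢ) (moveOut k i))
pexts-↓ˢ-moveOut σ Q zero rewrite ↓ˢ-↑ʳ {n = 1} σ zero = sym (wk0-closed Q)
pexts-↓ˢ-moveOut {k} σ Q (suc i) with splitAt k i in split
... | inj₁ a = begin
    pren suc ((σ ↓ˢ) i) [ Q /0]                    ≡⟨ weaken-[/0] ((σ ↓ˢ) i) Q ⟩
    (σ ↓ˢ) i                                       ≡⟨ cong (σ ↓ˢ) (sym (splitAt⁻¹-↑ˡ split)) ⟩
    (σ ↓ˢ) (a ↑ˡ 0)                                ≡⟨ ↓ˢ-↑ˡ 0 σ a ⟩
    wk0 (lookup σ a ↓)                             ≡⟨ sym (psub-wk0 _ (lookup σ a ↓)) ⟩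
    psub (single (wk0 Q)) (wk0 (lookup σ a ↓))     ≡⟨ cong (psub (single (wk0 Q))) (sym (↓ˢ-↑ˡ 1 σ a)) ⟩
    psub (single (wk0 Q)) ((σ ↓ˢ) (a ↑ˡ 1))        ∎

β-↓ : ∀ {k} (M : ETm (suc (k + 0))) (σ : Vec (ETm 0) k) (N : ETm 0) →
      psub (pexts (σ ↓ˢ)) (M ↓) [ N ↓ /0] ≡ es (eren (moveOut k) M ^ σ) N ↓
β-↓ {k} M σ N = begin
    psub (single (N ↓)) (psub (pexts (σ ↓ˢ)) (M ↓))
  ≡⟨ psub-psub _ _ (M ↓) ⟩
    psub (psub (single (N ↓)) ∘ pexts (σ ↓ˢ)) (M ↓)
  ≡⟨ psub-cong (pexts-↓ˢ-moveOut σ (N ↓)) (M ↓) ⟩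
    psub (psub N′ ∘ (σ ↓ˢ) ∘ moveOut k) (M ↓)
  ≡⟨ sym (psub-pren _ (moveOut k) (M ↓)) ⟩
    psub (psub N′ ∘ (σ ↓ˢ)) (pren (moveOut k) (M ↓))
  ≡⟨ sym (psub-psub N′ (σ ↓ˢ) (pren (moveOut k) (M ↓))) ⟩
    psub N′ (psub (σ ↓ˢ) (pren (moveOut k) (M ↓)))
  ≡⟨ cong (psub N′ ∘ psub (σ ↓ˢ)) (sym (eren-↓ (moveOut k) M)) ⟩
    psub N′ (psub (σ ↓ˢ) (eren (moveOut k) M ↓))
  ≡⟨ cong (psub N′) (sym (^-↓ (eren (moveOut k) M) σ)) ⟩
    psub N′ ((eren (moveOut k) M ^ σ) ↓)
  ∎
  where
  N′ : Fin 1 → PTm 0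
  N′ = single (wk0 (N ↓))

enum-↓ : ∀ {n} k → enum {n} k ↓ ≡ pnum k
enum-↓ zero    = refl
enum-↓ (suc k) = cong succ (enum-↓ k)

_↓ᶜ : ECtx → PCtx 0
hole ↓ᶜ         = hole
appC E N ↓ᶜ     = appC (E ↓ᶜ) (N ↓)
predC E ↓ᶜ      = predC (E ↓ᶜ)
succC E ↓ᶜ      = succC (E ↓ᶜ)
ifzC E N L ↓ᶜ   = ifzC (E ↓ᶜ) (N ↓) (L ↓)

eplug-↓ : ∀ E M → eplug E M ↓ ≡ pplug (E ↓ᶜ) (M ↓)
eplug-↓ hole         M = refl
eplug-↓ (appC E N)   M = cong (λ P → app P (N ↓)) (eplug-↓ E M)
eplug-↓ (predC E)    M = cong pred (eplug-↓ E M)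
eplug-↓ (succC E)    M = cong succ (eplug-↓ E M)
eplug-↓ (ifzC E N L) M = cong (λ P → ifz P (N ↓) (L ↓)) (eplug-↓ E M)

⊳cr-↓ : ∀ {M N} → M ⊳cr N → (M ↓) ⊳PCF (N ↓)
⊳cr-↓ (β M σ N)    = subst₂ _⊳PCF_ (cong (λ P → app P (N ↓)) (sym (^-↓ (lam M) σ)))
                                   (β-↓ M σ N) (β _ (N ↓))
⊳cr-↓ pred0        = pred0
⊳cr-↓ (predS k)    rewrite enum-↓ {0} k = predS k
⊳cr-↓ (ifz0 M N)   = ifz0 _ _
⊳cr-↓ (ifzS k M N) rewrite enum-↓ {0} k = ifzS k _ _
⊳cr-↓ (fixβ M)     = fixβ _

⊳pr-↓ : ∀ {M N} → M ⊳pr N → (M ↓) ≡ (N ↓)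
⊳pr-↓ (varIn σ i)  = trans (^-↓ (var (i ↑ˡ 0)) σ) (trans (↓ˢ-↑ˡ 0 σ i) (wk0-closed _))
⊳pr-↓ (varOut σ ())
⊳pr-↓ (zer^ σ)     = ^-↓ zer σ
⊳pr-↓ (app^ σ M N) rewrite ^-↓ (app M N) σ | ^-↓ M σ | ^-↓ N σ = refl
⊳pr-↓ (pred^ σ M)  rewrite ^-↓ (pred M) σ | ^-↓ M σ = refl
⊳pr-↓ (succ^ σ M)  rewrite ^-↓ (succ M) σ | ^-↓ M σ = refl
⊳pr-↓ (ifz^ σ L M N) rewrite ^-↓ (ifz L M N) σ | ^-↓ L σ | ^-↓ M σ | ^-↓ N σ = refl
⊳pr-↓ (fix^ σ M)   rewrite ^-↓ (fix M) σ | ^-↓ M σ = refl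

→cr-↓ : ∀ {M N} → M →cr N → (M ↓) →PCF (N ↓)
→cr-↓ (ctx E {M} {N} r) = subst₂ _→PCF_ (sym (eplug-↓ E M)) (sym (eplug-↓ E N)) (ctx (E ↓ᶜ) (⊳cr-↓ r))

→pr-↓ : ∀ {M N} → M →pr N → (M ↓) ≡ (N ↓)
→pr-↓ (ctx E {M} {N} r) = begin
  eplug E M ↓           ≡⟨ eplug-↓ E M ⟩
  pplug (E ↓ᶜ) (M ↓)    ≡⟨ cong (pplug (E ↓ᶜ)) (⊳pr-↓ r) ⟩
  pplug (E ↓ᶜ) (N ↓)    ≡⟨ sym (eplug-↓ E N) ⟩
  eplug E N ↓           ∎

proposition2p19 : ((M N : Program) → M →cr N → (M ↓) →PCF (N ↓))
                  × ((M N : Program) → M →pr N → (M ↓) ≡ (N ↓))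
proposition2p19 = (λ _ _ → →cr-↓) , (λ _ _ → →pr-↓)
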